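{- Let $\mathbf{M}$ be an MV-algebra and $\mathbf{A}=\mathbf{M}^M$ the corresponding functional CMV-algebra. Let $I$ be a $\diamond$-ideal of $\mathbf{A}$, let $a\in M$, and let $I(a)=\{f(a)\mid f\in I\}\subseteq M$. Then $I(a)$ is an MV-ideal of $\mathbf{M}$.
   Context: For an MV-algebra $\mathbf{M}=\langle M,\oplus,{}^*,0\rangle$, $\mathbf{M}^M$ is the set of all functions $M\to M$ with pointwise operations $\oplus,{}^*,0$, composition $\diamond=\circ$ ($(f\circ g)(x)=f(g(x))$) and the identity as neutral element; it is a CMV-algebra. Put $1=0^*$ and $x\le y$ iff $x^*\oplus y=1$ (pointwise in $M^M$). An MV-ideal is a non-empty subset closed downward and under $\oplus$. A $\diamond$-ideal of a CMV-algebra $A$ is a non-empty subset $I$ such that (i) $x\in I$, $y\le x$ imply $y\in I$; (ii) $x,y\in I$ imply $x\oplus y\in I$; (iii) $x\diamond y\in I$ for all $x\in I$, $y\in A$. -}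

module Defs where

open import Level using (Level; _⊔_; suc)
open import Relation.Binary.PropositionalEquality using (_≡_)
open import Data.Product using (Σ; ∃; _×_; _,_)

record MVAlgebra (c : Level) : Set (suc c) where
  infixl 6 _⊕_
  field
    Carrier : Set c
    _⊕_     : Carrier → Carrier → Carrier
    _*      : Carrier → Carrier
    𝟘       : Carrier
    ⊕-assoc : ∀ x y z → (x ⊕ y) ⊕ z ≡ x ⊕ (y ⊕ z)
    ⊕-comm  : ∀ x y → x ⊕ y ≡ y ⊕ x
    ⊕-identity : ∀ x → x ⊕ 𝟘 ≡ x
    *-involutive : ∀ x → (x *) * ≡ x
    ⊕-absorb : ∀ x → x ⊕ (𝟘 *) ≡ 𝟘 *
    łukasiewicz : ∀ x y → ((x *) ⊕ y) * ⊕ y ≡ ((y *) ⊕ x) * ⊕ x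

  𝟙 : Carrier
  𝟙 = 𝟘 *

  _≤_ : Carrier → Carrier → Set c
  x ≤ y = (x *) ⊕ y ≡ 𝟙

  IsMVIdeal : {ℓ : Level} → (Carrier → Set ℓ) → Set (c ⊔ ℓ)
  IsMVIdeal I = (Σ Carrier I)
              × (∀ x y → I x → y ≤ x → I y)
              × (∀ x y → I x → I y → I (x ⊕ y))

module Functional {c : Level} (𝐌 : MVAlgebra c) where
  open MVAlgebra 𝐌

  Fun : Set c
  Fun = Carrier → Carrier

  _⊕ᶠ_ : Fun → Fun → Fun
  (f ⊕ᶠ g) x = f x ⊕ g x

  _*ᶠ : Fun → Fun
  (f *ᶠ) x = (f x) *

  𝟘ᶠ : Fun
  𝟘ᶠ _ = 𝟘

  𝟙ᶠ : Fun
  𝟙ᶠ = 𝟘ᶠ *ᶠ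

  _⋄_ : Fun → Fun → Fun
  (f ⋄ g) x = f (g x)

  _≤ᶠ_ : Fun → Fun → Set c
  f ≤ᶠ g = ∀ x → ((f *ᶠ) ⊕ᶠ g) x ≡ 𝟙ᶠ x

  Is⋄Ideal : {ℓ : Level} → (Fun → Set ℓ) → Set (c ⊔ ℓ)
  Is⋄Ideal I = (Σ Fun I)
             × (∀ f g → I f → g ≤ᶠ f → I g)
             × (∀ f g → I f → I g → I (f ⊕ᶠ g))
             × (∀ f g → I f → I (f ⋄ g))

  evalAt : {ℓ : Level} → (Fun → Set ℓ) → Carrier → (Carrier → Set (c ⊔ ℓ))
  evalAt I a y = Σ Fun (λ f → I f × f a ≡ y)

module Submission where

-- The value set I(a) = { f(a) | f ∈ I }
-- of a ⋄-ideal I of M^M is controlled by constant functions: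
--   * every y ∈ M with I ∋ const y lies in I(a), since (const y)(a) = y;
--   * conversely, if f ∈ I then const (f a) = f ⋄ const a ∈ I, because a
--     ⋄-ideal absorbs composition on the right.
-- So I(a) is exactly the set of y with const y ∈ I, and the MV-ideal
-- properties of I(a) are inherited from those of I:
--   non-empty   : from any f ∈ I we get f(a) ∈ I(a);
--   downward    : y ≤ f(a) in M makes const y ≤ const (f a) pointwise in M^M,
--                 and const (f a) ∈ I, so const y ∈ I by downward closure;
--   closed by ⊕ : f(a) ⊕ g(a) = (f ⊕ g)(a) with f ⊕ g ∈ I.

open import Defs
open import Level using (Level)
open import Function using (const)
open import Data.Product using (Σ; _,_)
open import Relation.Binary.PropositionalEquality using (_≡_; refl)

module ConstantFunctions {c : Level} (𝐌 : MVAlgebra c) where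
  open MVAlgebra 𝐌
  open Functional 𝐌

  const-mono : ∀ {x y} → y ≤ x → const y ≤ᶠ const x
  const-mono y≤x _ = y≤x

  const∈⇒∈evalAt : ∀ {ℓ} {I : Fun → Set ℓ} (a y : Carrier) → I (const y) → evalAt I a y
  const∈⇒∈evalAt a y Iy = const y , Iy , refl

module ValuesOfIdeal {c ℓ : Level} (𝐌 : MVAlgebra c) (I : Functional.Fun 𝐌 → Set ℓ) (a : MVAlgebra.Carrier 𝐌) where
  open MVAlgebra 𝐌
  open Functional 𝐌
  open ConstantFunctions 𝐌

  evalAt-nonempty : Σ Fun I → Σ Carrier (evalAt I a)
  evalAt-nonempty (f , If) = f a , f , If , refl

  -- If I absorbs right composition, then the constant function with value
  -- any element of I(a) lies in I: f ⋄ const a is, definitionally, const (f a).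
  evalAt⇒const∈ : (∀ f g → I f → I (f ⋄ g)) → ∀ {y} → evalAt I a y → I (const y)
  evalAt⇒const∈ absorb (f , If , refl) = absorb f (const a) If

  evalAt-downward : (∀ f g → I f → I (f ⋄ g)) → (∀ f g → I f → g ≤ᶠ f → I g)
                  → ∀ x y → evalAt I a x → y ≤ x → evalAt I a y
  evalAt-downward absorb down x y Ix y≤x =
    const∈⇒∈evalAt a y (down (const x) (const y) (evalAt⇒const∈ absorb Ix) (const-mono y≤x))

  evalAt-⊕ : (∀ f g → I f → I g → I (f ⊕ᶠ g)) → ∀ x y → evalAt I a x → evalAt I a y → evalAt I a (x ⊕ y)
  evalAt-⊕ plus x y (f , If , refl) (g , Ig , refl) = f ⊕ᶠ g , plus f g If Ig , refl

mainTheorem10 : {c ℓ : Level} (𝐌 : MVAlgebra c) (I : Functional.Fun 𝐌 → Set ℓ)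
    → Functional.Is⋄Ideal 𝐌 I → (a : MVAlgebra.Carrier 𝐌)
    → MVAlgebra.IsMVIdeal 𝐌 (Functional.evalAt 𝐌 I a)
mainTheorem10 𝐌 I (nonempty , down , plus , absorb) a =
  evalAt-nonempty nonempty , evalAt-downward absorb down , evalAt-⊕ plus
  where open ValuesOfIdeal 𝐌 I a
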